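{- Let $r\ge 0$, $z\ge 0$ and $k\ge 2$ be integers, and put $d=r+z$. Let $G$ be a bipartite mixed graph in which every vertex is incident with at most $r$ edges and is the tail of at most $z$ arcs, and which has diameter $k$. Then: (a) If $r>0$ (and the parameters are non-degenerate in the sense that $v:=(d-1)^2+4z>0$ and $u_1^2\ne 1\ne u_2^2$, where $u_1,u_2$ are defined below), the number of vertices of $G$ is at most $$M_B(r,z,k)=2\left(A\,\frac{u_1^{k+1}-u_1}{u_1^2-1}+B\,\frac{u_2^{k+1}-u_2}{u_2^2-1}\right),$$ where $$u_1=\frac{d-1-\sqrt{v}}{2},\quad u_2=\frac{d-1+\sqrt{v}}{2},\quad A=\frac{\sqrt{v}-(d+1)}{2\sqrt{v}},\quad B=\frac{\sqrt{v}+(d+1)}{2\sqrt{v}}.$$ (b) If $r=0$ and $z=d>1$, the number of vertices of $G$ is at most $2\dfrac{d^{k+1}-1}{d^2-1}$ when $k$ is odd, and at most $2\dfrac{d^{k+1}-d}{d^2-1}$ when $k$ is even.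
   Context: A mixed graph $G$ consists of a finite vertex set $V$ together with a set of (undirected) edges, i.e. unordered pairs of distinct vertices, and a set of arcs, i.e. ordered pairs of distinct vertices (no loops, no multiple edges/arcs). Its associated digraph is obtained by replacing each edge $\{u,w\}$ by the two arcs $(u,w),(w,u)$. A path/walk in $G$ is a directed walk in the associated digraph (edges may be traversed in both directions, arcs only from tail to head). The distance $\mathrm{dist}(u,w)$ is the length of a shortest such walk from $u$ to $w$, and the diameter of $G$ is $\max_{u,w\in V}\mathrm{dist}(u,w)$ (over ordered pairs). $G$ is bipartite if $V$ can be partitioned into two sets such that every edge and every arc joins vertices in different sets. -}

module Defs where

open import Data.Nat using (ℕ; zero; suc; _+_; _*_; _∸_; _≤_; _<_)
open import Data.Bool using (Bool; true; false)
open import Data.Fin using (Fin)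
open import Data.List using (List; length; filterᵇ; allFin)
open import Data.Product using (Σ; _×_; ∃; ∃-syntax; _,_)
open import Relation.Nullary using (¬_)
open import Relation.Binary.PropositionalEquality using (_≡_; _≢_)

-- A mixed graph on the vertex set Fin n.
--   edge u w  = true  iff {u,w} is an (undirected) edge
--   arc  u w  = true  iff (u,w) is an arc (tail u, head w)
record MixedGraph (n : ℕ) : Set where
  field
    edge      : Fin n → Fin n → Bool
    arc       : Fin n → Fin n → Bool
    edge-sym  : ∀ u w → edge u w ≡ edge w u
    edge-irr  : ∀ u → edge u u ≡ false
    arc-irr   : ∀ u → arc u u ≡ false
open MixedGraph public

edgeDegree : ∀ {n} → MixedGraph n → Fin n → ℕ
edgeDegree {n} G v = length (filterᵇ (edge G v) (allFin n))

outArcDegree : ∀ {n} → MixedGraph n → Fin n → ℕ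
outArcDegree {n} G v = length (filterᵇ (arc G v) (allFin n))

data Step {n} (G : MixedGraph n) (u w : Fin n) : Set where
  viaEdge : edge G u w ≡ true → Step G u w
  viaArc  : arc G u w ≡ true → Step G u w

data Walk {n} (G : MixedGraph n) : Fin n → Fin n → ℕ → Set where
  here : ∀ {u} → Walk G u u 0
  step : ∀ {u v w ℓ} → Step G u v → Walk G v w ℓ → Walk G u w (suc ℓ)

IsDist : ∀ {n} → MixedGraph n → Fin n → Fin n → ℕ → Set
IsDist G u w ℓ = Walk G u w ℓ × (∀ m → m < ℓ → ¬ Walk G u w m)

-- diameter = max over ordered pairs of dist (in particular G is strongly connected)
HasDiameter : ∀ {n} → MixedGraph n → ℕ → Set
HasDiameter G k =
  (∀ u w → ∃[ ℓ ] (ℓ ≤ k × Walk G u w ℓ)) ×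
  (∃[ u ] ∃[ w ] IsDist G u w k)

IsBipartite : ∀ {n} → MixedGraph n → Set
IsBipartite {n} G = Σ (Fin n → Bool) λ c → ∀ (u w : Fin n) →
  (edge G u w ≡ true → c u ≢ c w) × (arc G u w ≡ true → c u ≢ c w)

-- Integer evaluation of the Moore-type bound M_B(r,z,k).
-- s m = A u₁^m + B u₂^m : s 0 = 1, s 1 = d, s (m+2) = (d-1) s (m+1) + z s m
momentSeq : ℕ → ℕ → ℕ → ℕ
momentSeq r z zero = 1
momentSeq r z (suc zero) = r + z
momentSeq r z (suc (suc m)) =
  ((r + z) ∸ 1) * momentSeq r z (suc m) + z * momentSeq r z m

-- g k = A (u₁^{k+1}-u₁)/(u₁²-1) + B (u₂^{k+1}-u₂)/(u₂²-1) :
-- g 0 = 0, g 1 = 1, g (k+2) = g k + s (k+1)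
halfBound : ℕ → ℕ → ℕ → ℕ
halfBound r z zero = 0
halfBound r z (suc zero) = 1
halfBound r z (suc (suc k)) = halfBound r z k + momentSeq r z (suc k)

MB : ℕ → ℕ → ℕ → ℕ
MB r z k = 2 * halfBound r z k

-- Fix a root u and sort the vertices by their distance t from u. Split the sphere at distance t
-- into the vertices entered along an edge from distance t - 1 and the others: a vertex of the
-- first kind spends one of its at most r edges pointing back, so it has at most r - 1 edges
-- leading further out, while every vertex has at most r edges and z out-arcs. So the two kinds
-- number at most mooreEdgeLayer and mooreArcLayer, whose sum s = momentSeq r z satisfies the
-- Moore recurrence s (t + 2) = (d - 1) s (t + 1) + z s t. In a bipartite graph the colour of
-- a vertex at distance t from u is determined by the parity of t, so the colour class seen by u
-- at distances k - 1, k - 3, ... has at most s (k - 1) + s (k - 3) + ... = halfBound r z k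
-- vertices. Taking as root u or a neighbour of u covers both colour classes, whence
-- n ≤ 2 * halfBound r z k = MB r z k. For r = 0 the sequence s is geometric, which gives the
-- closed forms of (b).
module Submission where

open import Defs
open import Level using (Level)
open import Data.Nat using (ℕ; zero; suc; _+_; _*_; _∸_; _^_; _≤_; _<_; z≤n; s≤s; z<s; NonZero; >-nonZero; pred; _≤′_; ≤′-refl; ≤′-step)
open import Data.Nat.Properties
  using ( ≤-refl; ≤-trans; ≤-reflexive; <-trans; <⇒≤; ≤⇒≤′; <⇒≤pred; n≤1+n; m≤n⇒m≤1+n; m<n⇒m<1+n
        ; +-comm; +-suc; +-identityʳ; +-mono-≤; +-monoʳ-≤; *-comm; *-assoc; *-suc; *-identityˡ; *-identityʳ
        ; *-monoˡ-≤; *-monoʳ-≤; m+n∸n≡m; suc-pred; m^n≢0; ^-distribˡ-+-*; module ≤-Reasoning )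
open import Data.Nat.DivMod using (_%_)
open import Data.Nat.GeneralisedArithmetic using (fold)
open import Data.Nat.Tactic.RingSolver using (solve-∀)
open import Data.Integer using (ℤ; +_; 0ℤ) renaming (_+_ to _+ℤ_; _-_ to _-ℤ_; _*_ to _*ℤ_; _<_ to _<ℤ_)
open import Data.Bool using (Bool; true; false; not)
open import Data.Bool.Properties using (T-≡; ¬-not; not-¬; not-involutive)
import Data.Bool.Properties as Bool
open import Data.Fin using (Fin; _≟_)
open import Data.Fin.Properties using (any?)
open import Data.List using (List; []; _∷_; length; filter; allFin)
open import Data.List.Properties using (filter-none; filter-all; length-tabulate)
open import Data.List.Membership.Propositional using (_∈_; lose)
open import Data.List.Membership.Propositional.Properties using (∈-allFin)
open import Data.List.Relation.Unary.Any using (Any; here; there)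
import Data.List.Relation.Unary.Any as Any
open import Data.List.Relation.Unary.All as All using (All)
open import Data.List.Relation.Unary.AllPairs using (_∷_)
open import Data.List.Relation.Unary.Unique.Propositional using (Unique)
open import Data.List.Relation.Unary.Unique.Propositional.Properties using (allFin⁺)
open import Data.Empty using (⊥)
open import Data.Product using (∃-syntax; _×_; _,_; proj₁; proj₂)
open import Data.Sum using (_⊎_; inj₁; inj₂; [_,_])
import Data.Sum as Sum
open import Function using (_∘_; id; Equivalence)
open import Relation.Nullary using (¬_; Dec; yes; no; contradiction)
open import Relation.Nullary.Decidable using (_×-dec_; _⊎-dec_; ¬?; map′)
open import Relation.Unary using (Pred; Decidable; _⊆_; _∪_; ∁; U)
open import Relation.Binary.PropositionalEquality
  using (_≡_; _≢_; refl; sym; trans; cong; cong₂; subst; ≢-sym; module ≡-Reasoning)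

module _ {a} {A : Set a} where

  private
    variable
      p : Level
      P Q R : Pred A p

  count : Decidable P → List A → ℕ
  count P? xs = length (filter P? xs)

  count-none : (P? : Decidable P) {xs : List A} → All (∁ P) xs → count P? xs ≡ 0
  count-none P? none = cong length (filter-none P? none)

  count≤count∷ : (P? : Decidable P) (x : A) (xs : List A) → count P? xs ≤ count P? (x ∷ xs)
  count≤count∷ P? x xs with P? x
  ... | yes _ = n≤1+n _
  ... | no _  = ≤-refl

  count-mono : (P? : Decidable P) (Q? : Decidable Q) → P ⊆ Q → ∀ xs → count P? xs ≤ count Q? xs
  count-mono P? Q? P⊆Q [] = z≤n
  count-mono P? Q? P⊆Q (x ∷ xs) with P? x | Q? x
  ... | yes _  | yes _  = s≤s (count-mono P? Q? P⊆Q xs)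
  ... | yes px | no ¬qx = contradiction (P⊆Q px) ¬qx
  ... | no _   | yes _  = m≤n⇒m≤1+n (count-mono P? Q? P⊆Q xs)
  ... | no _   | no _   = count-mono P? Q? P⊆Q xs

  count-∪ : (P? : Decidable P) (Q? : Decidable Q) (R? : Decidable R) → P ⊆ Q ∪ R →
            ∀ xs → count P? xs ≤ count Q? xs + count R? xs
  count-∪ P? Q? R? P⊆Q∪R [] = z≤n
  count-∪ P? Q? R? P⊆Q∪R (x ∷ xs) with ih ← count-∪ P? Q? R? P⊆Q∪R xs | P? x
  ... | no _ = ≤-trans ih (+-mono-≤ (count≤count∷ Q? x xs) (count≤count∷ R? x xs))
  ... | yes px with Q? x
  ...   | yes _ = s≤s (≤-trans ih (+-monoʳ-≤ _ (count≤count∷ R? x xs)))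
  ...   | no ¬qx with R? x
  ...     | yes _  = ≤-trans (s≤s ih) (≤-reflexive (sym (+-suc _ _)))
  ...     | no ¬rx = contradiction (P⊆Q∪R px) [ ¬qx , ¬rx ]

  count-< : (P? : Decidable P) (Q? : Decidable Q) → P ⊆ Q →
            ∀ {y xs} → y ∈ xs → Q y → ¬ P y → count P? xs < count Q? xs
  count-< P? Q? P⊆Q {xs = y ∷ xs} (here refl) qy ¬py with P? y | Q? y
  ... | yes py | _      = contradiction py ¬py
  ... | no _   | yes _  = s≤s (count-mono P? Q? P⊆Q xs)
  ... | no _   | no ¬qy = contradiction qy ¬qy
  count-< P? Q? P⊆Q {xs = x ∷ xs} (there y∈xs) qy ¬py
    with ih ← count-< P? Q? P⊆Q y∈xs qy ¬py | P? x | Q? x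
  ... | yes _  | yes _  = s≤s ih
  ... | yes px | no ¬qx = contradiction (P⊆Q px) ¬qx
  ... | no _   | yes _  = m<n⇒m<1+n ih
  ... | no _   | no _   = ih

  count-≤1 : (P? : Decidable P) {xs : List A} → Unique xs →
             (∀ {x y} → P x → P y → x ≡ y) → count P? xs ≤ 1
  count-≤1 P? {[]} _ _ = z≤n
  count-≤1 P? {x ∷ xs} (x∉xs ∷ unique) P-unique with P? x
  ... | yes px = s≤s (≤-reflexive (count-none P? (All.map (λ x≢y py → x≢y (P-unique px py)) x∉xs)))
  ... | no _   = count-≤1 P? unique P-unique

  length-≤-count-∪ : (P? : Decidable P) (Q? : Decidable Q) → (∀ x → P x ⊎ Q x) →
                     ∀ xs → length xs ≤ count P? xs + count Q? xs
  length-≤-count-∪ P? Q? cover xs =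
    subst (_≤ count P? xs + count Q? xs) (cong length (filter-all U? (All.universal _ xs)))
          (count-∪ U? P? Q? (λ {x} _ → cover x) xs)
    where
    U? : Decidable {A = A} U
    U? _ = yes _

module _ {a b q s} {A : Set a} {B : Set b} {Q : B → Pred A q} {S : Pred B s}
         (Q? : ∀ x → Decidable (Q x)) (S? : Decidable S) where

  count-⋃ : ∀ {m} (ys : List A) → (∀ {x} → S x → count (Q? x) ys ≤ m) →
            ∀ xs → count (λ w → Any.any? (λ x → S? x ×-dec Q? x w) xs) ys ≤ m * count S? xs
  count-⋃ ys bound [] = ≤-trans (≤-reflexive (count-none _ (All.universal (λ _ ()) ys))) z≤n
  count-⋃ {m} ys bound (x ∷ xs) with S? x
  ... | yes sx = begin
    count _ ys                   ≤⟨ count-∪ _ (Q? x) _ split ys ⟩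
    count (Q? x) ys + count _ ys ≤⟨ +-mono-≤ (bound sx) (count-⋃ ys bound xs) ⟩
    m + m * count S? xs          ≡⟨ *-suc m _ ⟨
    m * suc (count S? xs)        ∎
    where
    open ≤-Reasoning
    split : ∀ {w} → Any (λ y → S y × Q y w) (x ∷ xs) → Q x w ⊎ Any (λ y → S y × Q y w) xs
    split (here (_ , qw)) = inj₁ qw
    split (there any) = inj₂ any
  ... | no ¬sx = ≤-trans (count-mono _ _ skip ys) (count-⋃ ys bound xs)
    where
    skip : ∀ {w} → Any (λ y → S y × Q y w) (x ∷ xs) → Any (λ y → S y × Q y w) xs
    skip (here (sx , _)) = contradiction sx ¬sx
    skip (there any) = any

∣_∣ : ∀ {n} {P : Fin n → Set} → Decidable P → ℕ
∣_∣ {n} P? = count P? (allFin n)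

mutual
  mooreEdgeLayer : ℕ → ℕ → ℕ → ℕ
  mooreEdgeLayer r z zero = 0
  mooreEdgeLayer r z (suc t) = (r ∸ 1) * mooreEdgeLayer r z t + r * mooreArcLayer r z t

  mooreArcLayer : ℕ → ℕ → ℕ → ℕ
  mooreArcLayer r z zero = 1
  mooreArcLayer r z (suc t) = z * (mooreEdgeLayer r z t + mooreArcLayer r z t)

mooreLayer : ℕ → ℕ → ℕ → ℕ
mooreLayer r z t = mooreEdgeLayer r z t + mooreArcLayer r z t

mooreLayer-recurrence : ∀ r z t →
  mooreLayer r z (2 + t) ≡ (r + z ∸ 1) * mooreLayer r z (1 + t) + z * mooreLayer r z t
mooreLayer-recurrence (suc r) z t = identity r z (mooreEdgeLayer (suc r) z (suc t)) (mooreLayer (suc r) z t)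
  where
  identity : ∀ r z e s → (r * e + suc r * (z * s)) + z * (e + z * s) ≡ (r + z) * (e + z * s) + z * s
  identity = solve-∀
mooreLayer-recurrence zero zero t = refl
mooreLayer-recurrence zero (suc z) t = identity z (mooreLayer zero (suc z) t)
  where
  identity : ∀ z s → suc z * (0 + suc z * s) ≡ z * (0 + suc z * s) + suc z * s
  identity = solve-∀

mooreLayer≡momentSeq : ∀ r z t → mooreLayer r z t ≡ momentSeq r z t
mooreLayer≡momentSeq r z zero = refl
mooreLayer≡momentSeq r z (suc zero) = identity (r ∸ 1) r z
  where
  identity : ∀ a r z → (a * 0 + r * 1) + z * (0 + 1) ≡ r + z
  identity = solve-∀
mooreLayer≡momentSeq r z (suc (suc t)) =
  trans (mooreLayer-recurrence r z t)
        (cong₂ (λ a b → (r + z ∸ 1) * a + z * b) (mooreLayer≡momentSeq r z (suc t)) (mooreLayer≡momentSeq r z t))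

module _ (z : ℕ) .{{_ : NonZero z}} where

  momentSeq-digraph : ∀ t → momentSeq 0 z t ≡ z ^ t
  momentSeq-digraph zero = refl
  momentSeq-digraph (suc zero) = sym (*-identityʳ z)
  momentSeq-digraph (suc (suc t)) = begin
    pred z * momentSeq 0 z (suc t) + z * momentSeq 0 z t
      ≡⟨ cong₂ (λ a b → pred z * a + z * b) (momentSeq-digraph (suc t)) (momentSeq-digraph t) ⟩
    pred z * z ^ suc t + z ^ suc t   ≡⟨ +-comm _ (z ^ suc t) ⟩
    suc (pred z) * z ^ suc t         ≡⟨ cong (_* z ^ suc t) (suc-pred z) ⟩
    z ^ suc (suc t)                  ∎
    where open ≡-Reasoning

  private
    suc[z²∸1]≡z² : suc (z ^ 2 ∸ 1) ≡ z ^ 2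
    suc[z²∸1]≡z² = suc-pred (z ^ 2) {{m^n≢0 z 2}}

  halfBound-digraph-step : ∀ k {c} → halfBound 0 z k * (z ^ 2 ∸ 1) + c ≡ z ^ suc k →
                           halfBound 0 z (2 + k) * (z ^ 2 ∸ 1) + c ≡ z ^ (3 + k)
  halfBound-digraph-step k {c} ih = begin
    (g + momentSeq 0 z (suc k)) * D + c  ≡⟨ cong (λ s → (g + s) * D + c) (momentSeq-digraph (suc k)) ⟩
    (g + X) * D + c                      ≡⟨ regroup g X D c ⟩
    (g * D + c) + X * D                  ≡⟨ cong (_+ X * D) ih ⟩
    X + X * D                            ≡⟨ *-suc X D ⟨
    X * suc D                            ≡⟨ cong (X *_) suc[z²∸1]≡z² ⟩
    X * z ^ 2                            ≡⟨ *-comm X (z ^ 2) ⟩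
    z ^ 2 * X                            ≡⟨ ^-distribˡ-+-* z 2 (suc k) ⟨
    z ^ (3 + k)                          ∎
    where
    open ≡-Reasoning
    g = halfBound 0 z k
    X = z ^ suc k
    D = z ^ 2 ∸ 1
    regroup : ∀ g x d c → (g + x) * d + c ≡ (g * d + c) + x * d
    regroup = solve-∀

  halfBound-digraph-odd : ∀ k → k % 2 ≡ 1 → halfBound 0 z k * (z ^ 2 ∸ 1) + 1 ≡ z ^ suc k
  halfBound-digraph-odd (suc zero) _ =
    trans (cong (_+ 1) (*-identityˡ (z ^ 2 ∸ 1))) (trans (+-comm (z ^ 2 ∸ 1) 1) suc[z²∸1]≡z²)
  halfBound-digraph-odd (suc (suc k)) odd = halfBound-digraph-step k (halfBound-digraph-odd k odd)

  halfBound-digraph-even : ∀ k → k % 2 ≡ 0 → halfBound 0 z k * (z ^ 2 ∸ 1) + z ≡ z ^ suc k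
  halfBound-digraph-even zero _ = sym (*-identityʳ z)
  halfBound-digraph-even (suc (suc k)) even = halfBound-digraph-step k (halfBound-digraph-even k even)

  private
    MB-digraph : ∀ k {c} → halfBound 0 z k * (z ^ 2 ∸ 1) + c ≡ z ^ suc k →
                 MB 0 z k * (z ^ 2 ∸ 1) ≡ 2 * (z ^ (k + 1) ∸ c)
    MB-digraph k {c} eq = begin
      2 * g * D            ≡⟨ *-assoc 2 g D ⟩
      2 * (g * D)          ≡⟨ cong (2 *_) (m+n∸n≡m (g * D) c) ⟨
      2 * (g * D + c ∸ c)  ≡⟨ cong (λ N → 2 * (N ∸ c)) eq ⟩
      2 * (z ^ suc k ∸ c)  ≡⟨ cong (λ e → 2 * (z ^ e ∸ c)) (+-comm 1 k) ⟩
      2 * (z ^ (k + 1) ∸ c) ∎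
      where
      open ≡-Reasoning
      g = halfBound 0 z k
      D = z ^ 2 ∸ 1

  MB-digraph-odd : ∀ k → k % 2 ≡ 1 → MB 0 z k * (z ^ 2 ∸ 1) ≡ 2 * (z ^ (k + 1) ∸ 1)
  MB-digraph-odd k odd = MB-digraph k (halfBound-digraph-odd k odd)

  MB-digraph-even : ∀ k → k % 2 ≡ 0 → MB 0 z k * (z ^ 2 ∸ 1) ≡ 2 * (z ^ (k + 1) ∸ z)
  MB-digraph-even k even = MB-digraph k (halfBound-digraph-even k even)

step? : ∀ {n} (G : MixedGraph n) x w → Dec (Step G x w)
step? G x w = map′ [ viaEdge , viaArc ] split (edge G x w Bool.≟ true ⊎-dec arc G x w Bool.≟ true)
  where
  split : Step G x w → edge G x w ≡ true ⊎ arc G x w ≡ true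
  split (viaEdge e) = inj₁ e
  split (viaArc a) = inj₂ a

module BreadthFirst {n} (G : MixedGraph n) (u : Fin n) where

  Ball : ℕ → Fin n → Set
  Ball zero w = u ≡ w
  Ball (suc t) w = Ball t w ⊎ ∃[ x ] (Ball t x × Step G x w)

  ball? : ∀ t → Decidable (Ball t)
  ball? zero = u ≟_
  ball? (suc t) w = ball? t w ⊎-dec any? (λ x → ball? t x ×-dec step? G x w)

  Sphere : ℕ → Fin n → Set
  Sphere zero = Ball zero
  Sphere (suc t) w = Ball (suc t) w × ¬ Ball t w

  sphere? : ∀ t → Decidable (Sphere t)
  sphere? zero = ball? zero
  sphere? (suc t) w = ball? (suc t) w ×-dec ¬? (ball? t w)

  EdgeSphere : ℕ → Fin n → Set
  EdgeSphere zero w = ⊥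
  EdgeSphere (suc t) w = Sphere (suc t) w × ∃[ x ] (Sphere t x × edge G x w ≡ true)

  edgeSphere? : ∀ t → Decidable (EdgeSphere t)
  edgeSphere? zero w = no λ ()
  edgeSphere? (suc t) w = sphere? (suc t) w ×-dec any? (λ x → sphere? t x ×-dec edge G x w Bool.≟ true)

  ArcSphere : ℕ → Fin n → Set
  ArcSphere t w = Sphere t w × ¬ EdgeSphere t w

  arcSphere? : ∀ t → Decidable (ArcSphere t)
  arcSphere? t w = sphere? t w ×-dec ¬? (edgeSphere? t w)

  ball-mono : ∀ {s t w} → s ≤ t → Ball s w → Ball t w
  ball-mono = go ∘ ≤⇒≤′
    where
    go : ∀ {s t w} → s ≤′ t → Ball s w → Ball t w
    go ≤′-refl = λ b → b
    go (≤′-step s≤t) = inj₁ ∘ go s≤t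

  ball-walk : ∀ {t v w ℓ} → Ball t v → Walk G v w ℓ → Ball (ℓ + t) w
  ball-walk b here = b
  ball-walk {t} {w = w} {suc ℓ} b (step s p) =
    subst (λ m → Ball m w) (+-suc ℓ t) (ball-walk (inj₂ (_ , b , s)) p)

  ball-reach : ∀ {k w} → ∃[ ℓ ] (ℓ ≤ k × Walk G u w ℓ) → Ball k w
  ball-reach (ℓ , ℓ≤k , p) = ball-mono (≤-trans (≤-reflexive (+-identityʳ ℓ)) ℓ≤k) (ball-walk refl p)

  sphere⇒ball : ∀ {t w} → Sphere t w → Ball t w
  sphere⇒ball {zero} b = b
  sphere⇒ball {suc t} (b , _) = b

  ball-suc⇒ball⊎sphere : ∀ {t w} → Ball (suc t) w → Ball t w ⊎ Sphere (suc t) w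
  ball-suc⇒ball⊎sphere {t} {w} b with ball? t w
  ... | yes b′ = inj₁ b′
  ... | no ¬b′ = inj₂ (b , ¬b′)

  sphere-predecessor : ∀ {t w} → Sphere (suc t) w → ∃[ x ] (Sphere t x × Step G x w)
  sphere-predecessor (inj₁ b , ¬b) = contradiction b ¬b
  sphere-predecessor {zero} (inj₂ (x , bx , s) , _) = x , bx , s
  sphere-predecessor {suc t} (inj₂ (x , bx , s) , ¬b) = x , (bx , λ bx′ → ¬b (inj₂ (x , bx′ , s))) , s

  sphere⇒edgeSphere⊎arcSphere : ∀ {t w} → Sphere t w → EdgeSphere t w ⊎ ArcSphere t w
  sphere⇒edgeSphere⊎arcSphere {t} {w} s with edgeSphere? t w
  ... | yes e = inj₁ e
  ... | no ¬e = inj₂ (s , ¬e)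

  arcSphere-predecessor : ∀ {t w} → ArcSphere (suc t) w → ∃[ x ] (Sphere t x × arc G x w ≡ true)
  arcSphere-predecessor (s , ¬e) with sphere-predecessor s
  ... | x , sx , viaEdge e = contradiction (s , x , sx , e) ¬e
  ... | x , sx , viaArc a = x , sx , a

  module _ (c : Fin n → Bool) (proper : ∀ {x w} → Step G x w → c x ≢ c w) where

    sphere-colour : ∀ {t w} → Sphere t w → c w ≡ fold (c u) not t
    sphere-colour {zero} refl = refl
    sphere-colour {suc t} s with sphere-predecessor s
    ... | x , sx , x→w = trans (¬-not (≢-sym (proper x→w))) (cong not (sphere-colour {t} sx))

  module _ {r z} (edge-deg : ∀ x → edgeDegree G x ≤ r) (arc-deg : ∀ x → outArcDegree G x ≤ z) where

    private
      edge-degree : ∀ x → ∣ (λ w → edge G x w Bool.≟ true) ∣ ≤ r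
      edge-degree x = ≤-trans (count-mono _ _ (Equivalence.from T-≡) (allFin n)) (edge-deg x)

      arc-degree : ∀ x → ∣ (λ w → arc G x w Bool.≟ true) ∣ ≤ z
      arc-degree x = ≤-trans (count-mono _ _ (Equivalence.from T-≡) (allFin n)) (arc-deg x)

      OutwardEdge : ℕ → Fin n → Fin n → Set
      OutwardEdge t x w = edge G x w ≡ true × Sphere (suc t) w

      outwardEdge? : ∀ t x → Decidable (OutwardEdge t x)
      outwardEdge? t x w = edge G x w Bool.≟ true ×-dec sphere? (suc t) w

      Reached : (Fin n → Set) → (Fin n → Fin n → Set) → Fin n → Set
      Reached S Q w = Any (λ x → S x × Q x w) (allFin n)

      reached? : ∀ {S Q} → Decidable S → (∀ x → Decidable (Q x)) → Decidable (Reached S Q)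
      reached? S? Q? w = Any.any? (λ x → S? x ×-dec Q? x w) (allFin n)

      reached : ∀ {S} Q {x w} → S x → Q x w → Reached S Q w
      reached _ sx qxw = lose (∈-allFin _) (sx , qxw)

    edgeSphere-outward : ∀ {t x} → EdgeSphere t x → ∣ outwardEdge? t x ∣ ≤ r ∸ 1
    edgeSphere-outward {suc t} {x} (_ , y , sy , y→x) =
      <⇒≤pred (≤-trans (count-< _ _ proj₁ (∈-allFin y) x→y y-inward) (edge-degree x))
      where
      x→y : edge G x y ≡ true
      x→y = trans (edge-sym G x y) y→x
      y-inward : ¬ (edge G x y ≡ true × Sphere (2 + t) y)
      y-inward (_ , _ , ¬b) = ¬b (inj₁ (sphere⇒ball sy))

    edgeSphere-suc-≤ : ∀ t → ∣ edgeSphere? (suc t) ∣ ≤ (r ∸ 1) * ∣ edgeSphere? t ∣ + r * ∣ arcSphere? t ∣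
    edgeSphere-suc-≤ t = begin
      ∣ edgeSphere? (suc t) ∣
        ≤⟨ count-∪ _ (reached? (edgeSphere? t) (outwardEdge? t)) (reached? (arcSphere? t) (outwardEdge? t))
                   split (allFin n) ⟩
      ∣ reached? (edgeSphere? t) (outwardEdge? t) ∣ + ∣ reached? (arcSphere? t) (outwardEdge? t) ∣
        ≤⟨ +-mono-≤ (count-⋃ (outwardEdge? t) (edgeSphere? t) (allFin n) edgeSphere-outward (allFin n))
                    (count-⋃ (outwardEdge? t) (arcSphere? t) (allFin n) outward (allFin n)) ⟩
      (r ∸ 1) * ∣ edgeSphere? t ∣ + r * ∣ arcSphere? t ∣
        ∎
      where
      open ≤-Reasoning
      split : EdgeSphere (suc t) ⊆ Reached (EdgeSphere t) (OutwardEdge t) ∪ Reached (ArcSphere t) (OutwardEdge t)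
      split (sw , x , sx , x→w) =
        Sum.map (λ ex → reached (OutwardEdge t) ex (x→w , sw)) (λ ax → reached (OutwardEdge t) ax (x→w , sw))
                (sphere⇒edgeSphere⊎arcSphere sx)
      outward : ∀ {x} → ArcSphere t x → ∣ outwardEdge? t x ∣ ≤ r
      outward {x} _ = ≤-trans (count-mono _ _ proj₁ (allFin n)) (edge-degree x)

    arcSphere-suc-≤ : ∀ t → ∣ arcSphere? (suc t) ∣ ≤ z * ∣ sphere? t ∣
    arcSphere-suc-≤ t = ≤-trans (count-mono _ _ predecessor (allFin n))
      (count-⋃ (λ x w → arc G x w Bool.≟ true) (sphere? t) (allFin n) (λ {x} _ → arc-degree x) (allFin n))
      where
      predecessor : ArcSphere (suc t) ⊆ Reached (Sphere t) (λ x w → arc G x w ≡ true)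
      predecessor a with x , sx , x→w ← arcSphere-predecessor a = reached (λ x w → arc G x w ≡ true) sx x→w

    sphere-≤-edgeSphere+arcSphere : ∀ t → ∣ sphere? t ∣ ≤ ∣ edgeSphere? t ∣ + ∣ arcSphere? t ∣
    sphere-≤-edgeSphere+arcSphere t = count-∪ _ _ _ sphere⇒edgeSphere⊎arcSphere (allFin n)

    ≤-mooreLayers : ∀ t → ∣ edgeSphere? t ∣ ≤ mooreEdgeLayer r z t × ∣ arcSphere? t ∣ ≤ mooreArcLayer r z t
    ≤-mooreLayers zero =
      ≤-reflexive (count-none _ (All.universal (λ _ ()) (allFin n))) ,
      ≤-trans (count-mono _ (ball? zero) proj₁ (allFin n)) (count-≤1 (u ≟_) (allFin⁺ n) (λ p q → trans (sym p) q))
    ≤-mooreLayers (suc t) with e , a ← ≤-mooreLayers t =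
      ≤-trans (edgeSphere-suc-≤ t) (+-mono-≤ (*-monoʳ-≤ (r ∸ 1) e) (*-monoʳ-≤ r a)) ,
      ≤-trans (arcSphere-suc-≤ t) (*-monoʳ-≤ z (≤-trans (sphere-≤-edgeSphere+arcSphere t) (+-mono-≤ e a)))

    sphere-≤-momentSeq : ∀ t → ∣ sphere? t ∣ ≤ momentSeq r z t
    sphere-≤-momentSeq t with e , a ← ≤-mooreLayers t =
      ≤-trans (sphere-≤-edgeSphere+arcSphere t) (≤-trans (+-mono-≤ e a) (≤-reflexive (mooreLayer≡momentSeq r z t)))

    module _ (c : Fin n → Bool) (proper : ∀ {x w} → Step G x w → c x ≢ c w) where

      private
        sphere-not-offColour : ∀ {t w} → Sphere t w → c w ≢ fold (c u) not (suc t)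
        sphere-not-offColour {t} s = not-¬ (sphere-colour c proper {t} s)

      OffColour : ℕ → Fin n → Set
      OffColour m w = Ball m w × c w ≡ fold (c u) not (suc m)

      offColour? : ∀ m → Decidable (OffColour m)
      offColour? m w = ball? m w ×-dec c w Bool.≟ fold (c u) not (suc m)

      offColour-≤-halfBound : ∀ m → ∣ offColour? m ∣ ≤ halfBound r z m
      offColour-≤-halfBound zero =
        ≤-reflexive (count-none _ (All.universal (λ _ (b , e) → sphere-not-offColour b e) (allFin n)))
      offColour-≤-halfBound (suc zero) =
        ≤-trans (count-mono _ (sphere? 0) inner (allFin n)) (sphere-≤-momentSeq 0)
        where
        inner : OffColour 1 ⊆ Sphere 0
        inner (b , e) with ball-suc⇒ball⊎sphere b
        ... | inj₁ b₀ = b₀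
        ... | inj₂ s₁ = contradiction e (sphere-not-offColour s₁)
      offColour-≤-halfBound (suc (suc m)) = begin
        ∣ offColour? (2 + m) ∣                  ≤⟨ count-∪ _ (sphere? (1 + m)) (offColour? m) split (allFin n) ⟩
        ∣ sphere? (1 + m) ∣ + ∣ offColour? m ∣  ≤⟨ +-mono-≤ (sphere-≤-momentSeq (1 + m)) (offColour-≤-halfBound m) ⟩
        momentSeq r z (1 + m) + halfBound r z m ≡⟨ +-comm (momentSeq r z (1 + m)) _ ⟩
        halfBound r z (2 + m)                   ∎
        where
        open ≤-Reasoning
        split : OffColour (2 + m) ⊆ Sphere (1 + m) ∪ OffColour m
        split (b , e) with ball-suc⇒ball⊎sphere b
        ... | inj₂ s = contradiction e (sphere-not-offColour s)
        ... | inj₁ b′ with ball-suc⇒ball⊎sphere b′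
        ...   | inj₁ b″ = inj₂ (b″ , trans e (not-involutive _))
        ...   | inj₂ s = inj₁ s

      colourClass-≤-halfBound : ∀ k → (∀ w → ∃[ ℓ ] (ℓ ≤ k × Walk G u w ℓ)) →
                                ∣ (λ w → c w Bool.≟ fold (c u) not (suc k)) ∣ ≤ halfBound r z k
      colourClass-≤-halfBound k reach =
        ≤-trans (count-mono _ (offColour? k) (λ {w} e → ball-reach (reach w) , e) (allFin n)) (offColour-≤-halfBound k)

fold-not : ∀ b t → fold (not b) not t ≡ not (fold b not t)
fold-not b zero = refl
fold-not b (suc t) = cong not (fold-not b t)

first-step : ∀ {n} {G : MixedGraph n} {u w k} → 1 ≤ k → Walk G u w k → ∃[ v ] Step G u v
first-step (s≤s _) (step u→v _) = _ , u→v

bipartite-≤-MB : ∀ {n r z k} (G : MixedGraph n) → 1 ≤ k → IsBipartite G →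
                 (∀ x → edgeDegree G x ≤ r) → (∀ x → outArcDegree G x ≤ z) → HasDiameter G k →
                 n ≤ MB r z k
bipartite-≤-MB {n} {r} {z} {k} G 1≤k (c , bipartite) edge-deg arc-deg (reach , u , _ , walk , _) = begin
  n                                     ≡⟨ length-tabulate {n = n} id ⟨
  length (allFin n)                     ≤⟨ length-≤-count-∪ (colour? true) (colour? false) two-colours (allFin n) ⟩
  ∣ colour? true ∣ + ∣ colour? false ∣  ≤⟨ +-mono-≤ (colourClass-bound true) (colourClass-bound false) ⟩
  halfBound r z k + halfBound r z k     ≡⟨ cong (_+_ (halfBound r z k)) (+-identityʳ _) ⟨
  MB r z k                              ∎
  where
  open ≤-Reasoning

  colour? : ∀ b → Decidable (λ w → c w ≡ b)
  colour? b w = c w Bool.≟ b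

  two-colours : ∀ w → c w ≡ true ⊎ c w ≡ false
  two-colours w with c w
  ... | true = inj₁ refl
  ... | false = inj₂ refl

  proper : ∀ {x w} → Step G x w → c x ≢ c w
  proper {x} {w} (viaEdge e) = proj₁ (bipartite x w) e
  proper {x} {w} (viaArc a) = proj₂ (bipartite x w) a

  colourClass-bound-from : ∀ x → ∣ colour? (fold (c x) not (suc k)) ∣ ≤ halfBound r z k
  colourClass-bound-from x = BreadthFirst.colourClass-≤-halfBound G x edge-deg arc-deg c proper k (reach x)

  colourClass-bound : ∀ b → ∣ colour? b ∣ ≤ halfBound r z k
  colourClass-bound b with b Bool.≟ fold (c u) not (suc k) | first-step 1≤k walk
  ... | yes refl | _ = colourClass-bound-from u
  ... | no b≢ | v , u→v = subst (λ b → ∣ colour? b ∣ ≤ halfBound r z k) colour-v (colourClass-bound-from v)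
    where
    colour-v : fold (c v) not (suc k) ≡ b
    colour-v = ≡.begin
      fold (c v) not (suc k)        ≡.≡⟨ cong (λ b → fold b not (suc k)) (¬-not (≢-sym (proper u→v))) ⟩
      fold (not (c u)) not (suc k)  ≡.≡⟨ fold-not (c u) (suc k) ⟩
      not (fold (c u) not (suc k))  ≡.≡⟨ ¬-not b≢ ⟨
      b                             ≡.∎
      where module ≡ = ≡-Reasoning

proposition1 : (r z k : ℕ) → 2 ≤ k →
    (n : ℕ) (G : MixedGraph n) →
    IsBipartite G →
    (∀ (x : Fin n) → edgeDegree G x ≤ r) →
    (∀ (x : Fin n) → outArcDegree G x ≤ z) →
    HasDiameter G k →
    -- (a)  r > 0, v = (d-1)^2 + 4z > 0, and u₁² ≠ 1 ≠ u₂², i.e. neither 1 nor -1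
    --      is a root of u² - (d-1)u - z (whose roots are u₁, u₂)
    (0 < r →
      0ℤ <ℤ ((+ (r + z) -ℤ + 1) *ℤ (+ (r + z) -ℤ + 1) +ℤ + 4 *ℤ + z) →
      (+ 1 -ℤ (+ (r + z) -ℤ + 1) -ℤ + z) ≢ 0ℤ →
      (+ 1 +ℤ (+ (r + z) -ℤ + 1) -ℤ + z) ≢ 0ℤ →
      n ≤ MB r z k)
    ×
    -- (b)  r = 0 and z = d > 1
    (r ≡ 0 → 1 < z →
      (k % 2 ≡ 1 → n * (z ^ 2 ∸ 1) ≤ 2 * (z ^ (k + 1) ∸ 1)) ×
      (k % 2 ≡ 0 → n * (z ^ 2 ∸ 1) ≤ 2 * (z ^ (k + 1) ∸ z)))
-- The extra hypotheses of (a) only make the closed form of M_B well defined; MB is its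
-- recurrence form, and n ≤ MB r z k holds without them.
proposition1 r z k 2≤k n G bipartite edge-deg arc-deg diameter = (λ _ _ _ _ → n≤MB) , digraph
  where
  n≤MB : n ≤ MB r z k
  n≤MB = bipartite-≤-MB G (<⇒≤ 2≤k) bipartite edge-deg arc-deg diameter

  digraph : r ≡ 0 → 1 < z →
    (k % 2 ≡ 1 → n * (z ^ 2 ∸ 1) ≤ 2 * (z ^ (k + 1) ∸ 1)) ×
    (k % 2 ≡ 0 → n * (z ^ 2 ∸ 1) ≤ 2 * (z ^ (k + 1) ∸ z))
  digraph r≡0 1<z = (λ odd → closed-form (MB-digraph-odd z k odd)) , (λ even → closed-form (MB-digraph-even z k even))
    where
    instance
      z≢0 : NonZero z
      z≢0 = >-nonZero (<-trans z<s 1<z)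
    closed-form : ∀ {N} → MB 0 z k * (z ^ 2 ∸ 1) ≡ N → n * (z ^ 2 ∸ 1) ≤ N
    closed-form eq = ≤-trans (*-monoˡ-≤ _ (subst (λ r → n ≤ MB r z k) r≡0 n≤MB)) (≤-reflexive eq)
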